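{- If a graph $G$ has a perfect matching, then $d_g'(G) \ge 2$.
   Context: All graphs are finite and simple. For a vertex $x$ of $G$, $N[x]$ denotes its closed neighborhood. The domatic number game on $G$ with palette $[k]=\{1,\dots,k\}$: two players, Alice and Bob, alternately choose a previously unchosen vertex of $G$ and assign it a color from $[k]$, until every vertex has been colored. Let $V_i$ be the set of vertices colored $i$. Alice wins if every $V_i$ ($i\in[k]$) is a dominating set of $G$, i.e. for every vertex $x$ and every color $c\in[k]$ some vertex of $N[x]$ has color $c$; otherwise Bob wins. In the $A$-game Alice moves first; in the $B$-game Bob moves first. The game domatic number $d_g(G)$ is the largest $k$ for which Alice has a winning strategy in the $A$-game with palette $[k]$, and the delayed game domatic number $d_g'(G)$ is the largest $k$ for which Alice has a winning strategy in the $B$-game with palette $[k]$. -}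

module Defs where

open import Data.Nat using (ℕ; _≤_)
open import Data.Fin using (Fin; _≟_)
open import Data.Bool using (Bool; true)
open import Data.Maybe using (Maybe; just; nothing)
open import Data.Product using (Σ; ∃; ∃-syntax; _×_; _,_)
open import Data.Sum using (_⊎_)
open import Relation.Nullary using (¬_; yes; no)
open import Relation.Binary.PropositionalEquality using (_≡_)

record Graph (n : ℕ) : Set where
  field
    adj   : Fin n → Fin n → Bool
    sym   : ∀ u v → adj u v ≡ true → adj v u ≡ true
    irref : ∀ v → ¬ (adj v v ≡ true)
open Graph public

InClosedNbhd : ∀ {n} → Graph n → Fin n → Fin n → Set
InClosedNbhd G x y = (y ≡ x) ⊎ (adj G x y ≡ true)

record PerfectMatching {n : ℕ} (G : Graph n) : Set₁ where
  field
    M        : Fin n → Fin n → Set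
    M-sym    : ∀ u v → M u v → M v u
    M-edge   : ∀ u v → M u v → adj G u v ≡ true
    covered  : ∀ v → ∃[ u ] M v u
    unique   : ∀ v u w → M v u → M v w → u ≡ w

HasPerfectMatching : ∀ {n} → Graph n → Set₁
HasPerfectMatching G = PerfectMatching G

-- Positions of the game with palette Fin k (colour i+1 ↔ Fin index i):
-- each vertex is uncoloured (nothing) or coloured.
Position : ℕ → ℕ → Set
Position n k = Fin n → Maybe (Fin k)

colour : ∀ {n k} → Position n k → Fin n → Fin k → Position n k
colour p v c u with u ≟ v
... | yes _ = just c
... | no  _ = p u

Uncoloured : ∀ {n k} → Position n k → Fin n → Set
Uncoloured p v = p v ≡ nothing

Full : ∀ {n k} → Position n k → Set
Full p = ∀ v → ¬ Uncoloured p v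

AllClassesDominating : ∀ {n k} → Graph n → Position n k → Set
AllClassesDominating G p = ∀ x c → ∃[ y ] (InClosedNbhd G x y × p y ≡ just c)

-- Alice has a winning strategy from position p, Alice (resp. Bob) to move.
-- The game is finite, so the inductive (least fixed point) definition is exact.
mutual
  data AliceWinsAliceToMove {n : ℕ} (G : Graph n) (k : ℕ) (p : Position n k) : Set where
    endA  : Full p → AllClassesDominating G p → AliceWinsAliceToMove G k p
    moveA : (v : Fin n) → Uncoloured p v → (c : Fin k) →
            AliceWinsBobToMove G k (colour p v c) → AliceWinsAliceToMove G k p

  data AliceWinsBobToMove {n : ℕ} (G : Graph n) (k : ℕ) (p : Position n k) : Set where
    endB  : Full p → AllClassesDominating G p → AliceWinsBobToMove G k p
    moveB : (∃[ v ] Uncoloured p v) →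
            ((v : Fin n) → Uncoloured p v → (c : Fin k) →
               AliceWinsAliceToMove G k (colour p v c)) →
            AliceWinsBobToMove G k p

emptyPosition : ∀ {n k} → Position n k
emptyPosition _ = nothing

AliceWinsBGame : ∀ {n} → Graph n → ℕ → Set
AliceWinsBGame G k = AliceWinsBobToMove G k emptyPosition

-- d_g'(G) ≥ m : the largest k for which Alice wins the B-game is at least m,
-- i.e. Alice wins the B-game with some palette [k], k ≥ m.
DelayedGameDomaticAtLeast : ∀ {n} → Graph n → ℕ → Set
DelayedGameDomaticAtLeast G m = ∃[ k ] (m ≤ k × AliceWinsBGame G k)

{-# OPTIONS --safe #-}
module Submission where

-- Alice answers every move of Bob on a vertex v by colouring the partner of v in the perfect
-- matching with the other colour. Hence matched vertices are uncoloured together and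
-- otherwise carry different colours; at the end every closed neighbourhood N[x] contains x
-- and its partner, so it sees both colours.

open import Defs hiding (sym)
open import Data.Nat using (ℕ)
open import Data.Nat.Properties using (≤-refl)
open import Data.Fin using (Fin; zero; suc; _≟_; opposite)
open import Data.Fin.Properties using (any?; opposite-involutive)
open import Data.Fin.Subset using (Subset; _∈_; _⊂_)
open import Data.Fin.Subset.Properties using (⊂-trans)
open import Data.Fin.Subset.Induction using (Acc; acc; ⊂-wellFounded)
open import Data.Maybe using (just; nothing; is-nothing)
import Data.Maybe as Maybe
import Data.Maybe.Properties as Maybeₚ
open import Data.Product using (∃₂; _×_; _,_; proj₁; proj₂)
open import Data.Sum using (_⊎_; inj₁; inj₂)
open import Data.Vec using (tabulate)
open import Data.Vec.Properties using (lookup∘tabulate; []=⇒lookup; lookup⇒[]=)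
open import Function using (_∘_)
open import Algebra.Definitions using (Involutive)
open import Relation.Nullary using (¬_; yes; no; contradiction)
open import Relation.Unary using (Decidable)
open import Relation.Binary.PropositionalEquality

private
  variable
    n k : ℕ

locate : (x v u : Fin n) → x ≡ v ⊎ x ≡ u ⊎ x ≢ v × x ≢ u
locate x v u with x ≟ v | x ≟ u
... | yes x≡v | _       = inj₁ x≡v
... | no  _   | yes x≡u = inj₂ (inj₁ x≡u)
... | no  x≢v | no  x≢u = inj₂ (inj₂ (x≢v , x≢u))

colour-at : (p : Position n k) (v : Fin n) (c : Fin k) → colour p v c v ≡ just c
colour-at p v c with v ≟ v
... | yes _  = refl
... | no v≢v = contradiction refl v≢v

colour-elsewhere : (p : Position n k) {v w : Fin n} (c : Fin k) → w ≢ v → colour p v c w ≡ p w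
colour-elsewhere p {v} {w} c w≢v with w ≟ v
... | yes w≡v = contradiction w≡v w≢v
... | no  _   = refl

colour-colour-at₁ : (p : Position n k) {v u : Fin n} (c d : Fin k) → v ≢ u →
                    colour (colour p v c) u d v ≡ just c
colour-colour-at₁ p {v} c d v≢u = trans (colour-elsewhere (colour p v c) d v≢u) (colour-at p v c)

colour-colour-elsewhere : (p : Position n k) {v u w : Fin n} (c d : Fin k) → w ≢ v → w ≢ u →
                          colour (colour p v c) u d w ≡ p w
colour-colour-elsewhere p {v} c d w≢v w≢u =
  trans (colour-elsewhere (colour p v c) d w≢u) (colour-elsewhere p c w≢v)

uncoloured? : (p : Position n k) → Decidable (Uncoloured p)
uncoloured? p v = Maybeₚ.≡-dec _≟_ (p v) nothing

uncoloured : Position n k → Subset n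
uncoloured p = tabulate (is-nothing ∘ p)

∈-uncoloured⇒Uncoloured : (p : Position n k) {v : Fin n} → v ∈ uncoloured p → Uncoloured p v
∈-uncoloured⇒Uncoloured p {v} v∈
  with p v | trans (sym (lookup∘tabulate (is-nothing ∘ p) v)) ([]=⇒lookup v∈)
... | nothing | _ = refl

Uncoloured⇒∈-uncoloured : (p : Position n k) {v : Fin n} → Uncoloured p v → v ∈ uncoloured p
Uncoloured⇒∈-uncoloured p {v} pv≡nothing =
  lookup⇒[]= v _ (trans (lookup∘tabulate (is-nothing ∘ p) v) (cong is-nothing pv≡nothing))

colour-⊂ : (p : Position n k) {v : Fin n} (c : Fin k) →
           Uncoloured p v → uncoloured (colour p v c) ⊂ uncoloured p
colour-⊂ p {v} c pv≡nothing = shrinks , v , Uncoloured⇒∈-uncoloured p pv≡nothing , coloured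
  where
  shrinks : ∀ {w} → w ∈ uncoloured (colour p v c) → w ∈ uncoloured p
  shrinks {w} w∈ with w ≟ v
  ... | yes refl =
    contradiction (trans (sym (colour-at p w c)) (∈-uncoloured⇒Uncoloured (colour p w c) w∈)) λ ()
  ... | no  w≢v  = Uncoloured⇒∈-uncoloured p
                     (trans (sym (colour-elsewhere p c w≢v)) (∈-uncoloured⇒Uncoloured (colour p v c) w∈))

  coloured : ¬ v ∈ uncoloured (colour p v c)
  coloured v∈ with () ← trans (sym (colour-at p v c)) (∈-uncoloured⇒Uncoloured (colour p v c) v∈)

invariant⇒aliceWinsBobToMove :
  (G : Graph n) (Good : Position n k → Set) →
  (∀ {p} → Good p → Full p → AllClassesDominating G p) →
  (∀ {p v} c → Good p → Uncoloured p v →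
     ∃₂ λ u d → Uncoloured (colour p v c) u × Good (colour (colour p v c) u d)) →
  ∀ {p} → Good p → AliceWinsBobToMove G k p
invariant⇒aliceWinsBobToMove {k = k} G Good full⇒dominating reply {p} =
  wins (⊂-wellFounded (uncoloured p))
  where
  wins : ∀ {p} → Acc _⊂_ (uncoloured p) → Good p → AliceWinsBobToMove G k p
  wins {p} (acc smaller) good with any? (uncoloured? p)
  ... | no  none = endB full (full⇒dominating good full)
    where
    full : Full p
    full v pv≡nothing = none (v , pv≡nothing)
  ... | yes some = moveB some bob
    where
    bob : ∀ v → Uncoloured p v → ∀ c → AliceWinsAliceToMove G k (colour p v c)
    bob v pv≡nothing c with reply c good pv≡nothing
    ... | u , d , pu≡nothing , good′ =
      moveA u pu≡nothing d
        (wins (smaller (⊂-trans (colour-⊂ (colour p v c) d pu≡nothing) (colour-⊂ p c pv≡nothing)))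
              good′)

opposite-covers : (e c : Fin 2) → e ≡ c ⊎ opposite e ≡ c
opposite-covers zero       zero       = inj₁ refl
opposite-covers zero       (suc zero) = inj₂ refl
opposite-covers (suc zero) zero       = inj₂ refl
opposite-covers (suc zero) (suc zero) = inj₁ refl

module _ {G : Graph n} (PM : PerfectMatching G) where
  open PerfectMatching PM

  matched⇒≢ : ∀ {x y} → M x y → x ≢ y
  matched⇒≢ {x} xy refl = irref G x (M-edge x x xy)

  -- One equation covering both cases: partners are both uncoloured, or coloured c and σ c.
  Paired : (Fin k → Fin k) → Position n k → Set
  Paired σ p = ∀ {x y} → M x y → p y ≡ Maybe.map σ (p x)

  Paired-colourEdge : {σ : Fin k → Fin k} → Involutive _≡_ σ →
                      {p : Position n k} {v u : Fin n} (c : Fin k) →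
                      Paired σ p → M v u → Paired σ (colour (colour p v c) u (σ c))
  Paired-colourEdge {σ = σ} σ-inv {p} {v} {u} c paired vu {x} {y} xy with locate x v u
  ... | inj₁ refl rewrite unique x y u xy vu = begin
    colour (colour p x c) u (σ c) u          ≡⟨ colour-at (colour p x c) u (σ c) ⟩
    just (σ c)
      ≡⟨ cong (Maybe.map σ) (sym (colour-colour-at₁ p c (σ c) (matched⇒≢ vu))) ⟩
    Maybe.map σ (colour (colour p x c) u (σ c) x) ∎
    where open ≡-Reasoning
  ... | inj₂ (inj₁ refl) rewrite unique x y v xy (M-sym v x vu) = begin
    colour (colour p v c) x (σ c) v          ≡⟨ colour-colour-at₁ p c (σ c) (matched⇒≢ vu) ⟩
    just c                                   ≡⟨ cong just (sym (σ-inv c)) ⟩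
    just (σ (σ c))
      ≡⟨ cong (Maybe.map σ) (sym (colour-at (colour p v c) x (σ c))) ⟩
    Maybe.map σ (colour (colour p v c) x (σ c) x) ∎
    where open ≡-Reasoning
  ... | inj₂ (inj₂ (x≢v , x≢u)) = begin
    colour (colour p v c) u (σ c) y               ≡⟨ colour-colour-elsewhere p c (σ c) y≢v y≢u ⟩
    p y                                           ≡⟨ paired xy ⟩
    Maybe.map σ (p x)
      ≡⟨ cong (Maybe.map σ) (sym (colour-colour-elsewhere p c (σ c) x≢v x≢u)) ⟩
    Maybe.map σ (colour (colour p v c) u (σ c) x) ∎
    where
    open ≡-Reasoning
    y≢v : y ≢ v
    y≢v refl = x≢u (unique v x u (M-sym x v xy) vu)
    y≢u : y ≢ u
    y≢u refl = x≢v (unique u x v (M-sym x u xy) (M-sym v u vu))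

  Paired-reply : {σ : Fin k → Fin k} → Involutive _≡_ σ →
                 ∀ {p v} c → Paired σ p → Uncoloured p v →
                 ∃₂ λ u d → Uncoloured (colour p v c) u × Paired σ (colour (colour p v c) u d)
  Paired-reply {σ = σ} σ-inv {p} {v} c paired pv≡nothing =
    u , σ c , partner-uncoloured , Paired-colourEdge σ-inv c paired vu
    where
    u : Fin n
    u = proj₁ (covered v)
    vu : M v u
    vu = proj₂ (covered v)
    partner-uncoloured : Uncoloured (colour p v c) u
    partner-uncoloured = begin
      colour p v c u        ≡⟨ colour-elsewhere p c (matched⇒≢ vu ∘ sym) ⟩
      p u                   ≡⟨ paired vu ⟩
      Maybe.map σ (p v)     ≡⟨ cong (Maybe.map σ) pv≡nothing ⟩
      nothing               ∎
      where open ≡-Reasoning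

  Paired-opposite⇒dominating : ∀ {p} → Paired opposite p → Full p → AllClassesDominating G p
  Paired-opposite⇒dominating {p} paired full x c with p x in px | covered x
  ... | nothing | _ = contradiction px (full x)
  ... | just e | y , xy with opposite-covers e c
  ...   | inj₁ refl = x , inj₁ refl , px
  ...   | inj₂ refl = y , inj₂ (M-edge x y xy) , trans (paired xy) (cong (Maybe.map opposite) px)

lemma3p2 : (n : ℕ) (G : Graph n) → HasPerfectMatching G → DelayedGameDomaticAtLeast G 2
lemma3p2 n G PM =
  2 , ≤-refl ,
  invariant⇒aliceWinsBobToMove G (Paired PM opposite) (Paired-opposite⇒dominating PM)
    (Paired-reply PM opposite-involutive) (λ _ → refl)
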